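{- Let $n\geq m\geq3$ be odd integers and let $S\subseteq\mathbb{Z}_n$. If the circulant graph $\langle S\rangle_n$ decomposes into $t$ Hamiltonian cycles, then there exist $2t$ $C_n$-factors of $C_m[n]$ which between them exactly cover $C_m[\pm S]$.
   Context: The circulant graph $\langle S\rangle_n$ has vertex set $\mathbb{Z}_n$ and edges $\{a,a+d\}$ for $a\in\mathbb{Z}_n$, $d\in S$. $C_m[n]$ has vertex set $\mathbb{Z}_m\times\mathbb{Z}_n$ (vertex $(x,i)$ written $x_i$), with $x_i$ adjacent to $y_j$ iff $y=x\pm1$. For $D\subseteq\mathbb{Z}_n$, $C_m[D]$ is the subgraph with edges $x_i(x+1)_{i+d}$, $x\in\mathbb{Z}_m$, $i\in\mathbb{Z}_n$, $d\in D$, and $\pm S=S\cup(-S)$. A $C_n$-factor is a spanning subgraph all of whose components are $n$-cycles. A set of cycle factors of $C_m[n]$ covers $D$ if for every $d\in D$ all edges $x_i(x+1)_{i+d}$ appear in some cycle of the factors; it exactly covers $D$ (equivalently $C_m[D]$) if moreover every edge of the factors is of this form. -}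

module Defs where

open import Data.Nat using (ℕ; zero; suc; _+_; _*_; _∸_; _%_)
open import Data.Nat.DivMod using (m%n<n)
open import Data.Fin using (Fin; toℕ; fromℕ<)
open import Data.Fin.Subset using (Subset; _∈_)
open import Data.Product using (Σ; ∃; _×_; _,_; proj₁; proj₂)
open import Data.Sum using (_⊎_)
open import Relation.Binary.PropositionalEquality using (_≡_)

Odd : ℕ → Set
Odd n = Σ ℕ λ k → n ≡ suc (2 * k)

-- Arithmetic in ℤ_n, with ℤ_n represented by Fin n (residues 0..n-1)

infixl 6 _+ₙ_

_+ₙ_ : ∀ {n} → Fin n → Fin n → Fin n
_+ₙ_ {suc k} a b = fromℕ< (m%n<n (toℕ a + toℕ b) (suc k))

-ₙ_ : ∀ {n} → Fin n → Fin n
-ₙ_ {suc k} a = fromℕ< (m%n<n (suc k ∸ toℕ a) (suc k))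

sucₙ : ∀ {n} → Fin n → Fin n
sucₙ {suc k} a = fromℕ< (m%n<n (suc (toℕ a)) (suc k))

±_ : ∀ {n} → Subset n → Fin n → Set
(± S) d = (d ∈ S) ⊎ ((-ₙ d) ∈ S)

Injective : ∀ {A B : Set} → (A → B) → Set
Injective f = ∀ x y → f x ≡ f y → x ≡ y

Surjective : ∀ {A B : Set} → (A → B) → Set
Surjective {A} f = ∀ y → Σ A λ x → f x ≡ y

CircAdj : ∀ {n} → Subset n → Fin n → Fin n → Set
CircAdj {n} S u w = Σ (Fin n) λ d → d ∈ S × ((w ≡ u +ₙ d) ⊎ (u ≡ w +ₙ d))

-- A Hamiltonian cycle of ⟨S⟩_n: a cyclic ordering v_0 … v_{n-1} of all
-- n vertices (injective, hence bijective) with v_j ~ v_{j+1} (indices mod n).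
record HamCycle (n : ℕ) (S : Subset n) : Set where
  field
    vert : Fin n → Fin n
    inj  : Injective vert
    adj  : ∀ j → CircAdj S (vert j) (vert (sucₙ j))

CycEdge : ∀ {n S} → HamCycle n S → Fin n → Fin n → Set
CycEdge {n} C u w = Σ (Fin n) λ j →
  (vert j ≡ u × vert (sucₙ j) ≡ w) ⊎ (vert j ≡ w × vert (sucₙ j) ≡ u)
  where open HamCycle C

-- ⟨S⟩_n decomposes into t Hamiltonian cycles: there are t Hamiltonian cycles
-- (whose edges are edges of ⟨S⟩_n by construction) such that every edge of
-- ⟨S⟩_n lies in exactly one of them.
HamDecomp : (n : ℕ) → Subset n → ℕ → Set
HamDecomp n S t = Σ (Fin t → HamCycle n S) λ H →
  ∀ u w → CircAdj S u w →
    Σ (Fin t) (λ k → CycEdge (H k) u w) ×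
    (∀ k k′ → CycEdge (H k) u w → CycEdge (H k′) u w → k ≡ k′)

-- C_m[n] : vertex set ℤ_m × ℤ_n, x_i ~ y_j iff y = x ± 1

Vertex : ℕ → ℕ → Set
Vertex m n = Fin m × Fin n

LexAdj : ∀ {m n} → Vertex m n → Vertex m n → Set
LexAdj (x , i) (y , j) = (y ≡ sucₙ x) ⊎ (x ≡ sucₙ y)

-- A C_n-factor of C_m[n]: the mn vertices are partitioned into m vertex-disjoint
-- n-cycles (cyc c 0, …, cyc c (n-1)) of C_m[n]; the factor's edges are exactly
-- the edges {cyc c j, cyc c (j+1)} (indices mod n).
record CnFactor (m n : ℕ) : Set where
  field
    cyc  : Fin m → Fin n → Vertex m n
    inj  : ∀ c j c′ j′ → cyc c j ≡ cyc c′ j′ → (c ≡ c′ × j ≡ j′)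
    surj : ∀ v → Σ (Fin m) λ c → Σ (Fin n) λ j → cyc c j ≡ v
    adj  : ∀ c j → LexAdj (cyc c j) (cyc c (sucₙ j))

FactorEdge : ∀ {m n} → CnFactor m n → Vertex m n → Vertex m n → Set
FactorEdge {m} {n} F p q = Σ (Fin m) λ c → Σ (Fin n) λ j →
  (cyc c j ≡ p × cyc c (sucₙ j) ≡ q) ⊎ (cyc c j ≡ q × cyc c (sucₙ j) ≡ p)
  where open CnFactor F

InCmD : ∀ {m n} → (Fin n → Set) → Vertex m n → Vertex m n → Set
InCmD {m} {n} D (x , i) (y , j) = Σ (Fin n) λ d → D d ×
  ((y ≡ sucₙ x × j ≡ i +ₙ d) ⊎ (x ≡ sucₙ y × i ≡ j +ₙ d))

Covers : ∀ {m n k} → (Fin k → CnFactor m n) → (Fin n → Set) → Set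
Covers {m} {n} {k} Fs D = ∀ d → D d → ∀ (x : Fin m) (i : Fin n) →
  Σ (Fin k) λ l → FactorEdge (Fs l) (x , i) (sucₙ x , i +ₙ d)

ExactlyCovers : ∀ {m n k} → (Fin k → CnFactor m n) → (Fin n → Set) → Set
ExactlyCovers {m} {n} {k} Fs D =
  Covers Fs D × (∀ l p q → FactorEdge (Fs l) p q → InCmD D p q)

module Submission where

-- Let H = (v₀, …, v_{n-1}) be a Hamiltonian cycle of ⟨S⟩_n and let
-- w₀, …, w_{n-1} be a closed walk of length n in the cycle C_m (w_{j+1} = w_j ± 1 in
-- ℤ_m, indices mod n).  The m closed walks  c ↦ ((c + w₀)_{v₀}, …, (c + w_{n-1})_{v_{n-1}})
-- (c ∈ ℤ_m) are vertex-disjoint n-cycles covering C_m[n], i.e. a C_n-factor F(H,w).  Each of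
-- its edges joins x_{v_j} to (x ± 1)_{v_{j+1}} with v_{j+1} - v_j ∈ ±S, so F(H,w) ⊆ C_m[±S];
-- and where w ascends (w_{j+1} = w_j + 1) F(H,w) contains every edge x_{v_j} (x+1)_{v_{j+1}},
-- where it descends every edge x_{v_{j+1}} (x+1)_{v_j}.  Hence, given a Hamiltonian
-- decomposition H₁, …, H_t and walks w¹, …, wˢ such that at every step some walk ascends and
-- some walk descends, the st factors F(H_k, wʳ) exactly cover C_m[±S].

open import Defs
open import Data.Nat using (ℕ; zero; suc; _+_; _*_; _∸_; _%_; _/_; _≤_; _<_; s≤s; _<?_)
open import Data.Nat.Properties
open import Data.Nat.DivMod
open import Data.Fin using (Fin; toℕ; punchOut; remQuot; combine)
open import Data.Fin.Properties
  using (toℕ-fromℕ<; toℕ-injective; toℕ<n; punchOut-injective; any?; injective⇒≤; remQuot-combine)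
  renaming (_≟_ to _≟ᶠ_)
open import Data.Fin.Patterns using (0F; 1F)
open import Data.Fin.Subset using (Subset; _∈_)
open import Data.Product using (Σ; _×_; _,_; proj₁; proj₂)
open import Data.Sum using (_⊎_; inj₁; inj₂)
open import Relation.Binary.PropositionalEquality
open import Relation.Nullary using (yes; no)
open import Data.Empty using (⊥-elim)

injective⇒surjective : ∀ {m} (f : Fin m → Fin m) → Injective f → Surjective f
injective⇒surjective {suc m′} f inj y with any? (λ x → f x ≟ᶠ y)
... | yes hit = hit
... | no ¬hit = ⊥-elim (<-irrefl refl (injective⇒≤ {f = avoid} avoid-injective))
  where
  y≢f : ∀ x → y ≢ f x
  y≢f x e = ¬hit (x , sym e)
  -- f misses y, so it factors through Fin m′
  avoid : Fin (suc m′) → Fin m′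
  avoid x = punchOut (y≢f x)
  avoid-injective : ∀ {x x′} → avoid x ≡ avoid x′ → x ≡ x′
  avoid-injective {x} {x′} e = inj x x′ (punchOut-injective (y≢f x) (y≢f x′) e)

-- Arithmetic in ℤ_m (m = suc m′), computed in ℕ and reduced with  _mod_ : ℕ → Fin m.
module Modular (m′ : ℕ) where

  m : ℕ
  m = suc m′

  toℕ-mod : ∀ X → toℕ (X mod m) ≡ X % m
  toℕ-mod X = toℕ-fromℕ< (m%n<n X m)

  mod-cong : ∀ X Y → X % m ≡ Y % m → X mod m ≡ Y mod m
  mod-cong X Y e = toℕ-injective (trans (toℕ-mod X) (trans e (sym (toℕ-mod Y))))

  toℕ%m : ∀ (a : Fin m) → toℕ a % m ≡ toℕ a
  toℕ%m a = m<n⇒m%n≡m (toℕ<n a)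

  toℕ-mod-inverse : ∀ (a : Fin m) → toℕ a mod m ≡ a
  toℕ-mod-inverse a = toℕ-injective (trans (toℕ-mod (toℕ a)) (toℕ%m a))

  %-absorbʳ : ∀ X Y → (X + Y % m) % m ≡ (X + Y) % m
  %-absorbʳ X Y = begin
    (X + Y % m) % m           ≡⟨ %-distribˡ-+ X (Y % m) m ⟩
    (X % m + Y % m % m) % m   ≡⟨ cong (λ z → (X % m + z) % m) (m%n%n≡m%n Y m) ⟩
    (X % m + Y % m) % m       ≡⟨ %-distribˡ-+ X Y m ⟨
    (X + Y) % m               ∎
    where open ≡-Reasoning

  +-cong-% : ∀ X Y Z → Y % m ≡ Z % m → (X + Y) % m ≡ (X + Z) % m
  +-cong-% X Y Z e = trans (sym (%-absorbʳ X Y)) (trans (cong (λ z → (X + z) % m) e) (%-absorbʳ X Z))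

  *-cong-% : ∀ X Y Z → Y % m ≡ Z % m → (X * Y) % m ≡ (X * Z) % m
  *-cong-% X Y Z e = trans (%-distribˡ-* X Y m)
    (trans (cong (λ z → (X % m * z) % m) e) (sym (%-distribˡ-* X Z m)))

  +-inverse : ∀ X → X + (m ∸ X % m) ≡ suc (X / m) * m
  +-inverse X = begin
    X + (m ∸ r)           ≡⟨ cong (_+ (m ∸ r)) (m≡m%n+[m/n]*n X m) ⟩
    r + q + (m ∸ r)       ≡⟨ +-assoc r q (m ∸ r) ⟩
    r + (q + (m ∸ r))     ≡⟨ cong (r +_) (+-comm q (m ∸ r)) ⟩
    r + ((m ∸ r) + q)     ≡⟨ +-assoc r (m ∸ r) q ⟨
    r + (m ∸ r) + q       ≡⟨ cong (_+ q) (m+[n∸m]≡n (m%n≤n X m)) ⟩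
    m + q                 ∎
    where
    open ≡-Reasoning
    r = X % m
    q = X / m * m

  +-inverse-% : ∀ C X → (C + (X + (m ∸ X % m))) % m ≡ C % m
  +-inverse-% C X = trans (cong (λ z → (C + z) % m) (+-inverse X)) ([m+kn]%n≡m%n C (suc (X / m)) m)

  infixl 6 _⊕_ _⊖_

  _⊕_ : Fin m → ℕ → Fin m
  c ⊕ X = (toℕ c + X) mod m

  _⊖_ : Fin m → ℕ → Fin m
  x ⊖ X = x ⊕ (m ∸ X % m)

  ⊕-cong : ∀ c X Y → X % m ≡ Y % m → c ⊕ X ≡ c ⊕ Y
  ⊕-cong c X Y e = mod-cong (toℕ c + X) (toℕ c + Y) (+-cong-% (toℕ c) X Y e)

  ⊕-⊕ : ∀ c X Y → (c ⊕ X) ⊕ Y ≡ c ⊕ (X + Y)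
  ⊕-⊕ c X Y = mod-cong (toℕ (c ⊕ X) + Y) (toℕ c + (X + Y)) (begin
    (toℕ (c ⊕ X) + Y) % m    ≡⟨ cong (λ z → (z + Y) % m) (toℕ-mod (toℕ c + X)) ⟩
    ((toℕ c + X) % m + Y) % m ≡⟨ cong (_% m) (+-comm ((toℕ c + X) % m) Y) ⟩
    (Y + (toℕ c + X) % m) % m ≡⟨ %-absorbʳ Y (toℕ c + X) ⟩
    (Y + (toℕ c + X)) % m     ≡⟨ cong (_% m) (trans (+-comm Y (toℕ c + X)) (+-assoc (toℕ c) X Y)) ⟩
    (toℕ c + (X + Y)) % m     ∎)
    where open ≡-Reasoning

  ⊕-inverse : ∀ c X → c ⊕ (X + (m ∸ X % m)) ≡ c
  ⊕-inverse c X = trans (mod-cong (toℕ c + (X + (m ∸ X % m))) (toℕ c) (+-inverse-% (toℕ c) X))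
                        (toℕ-mod-inverse c)

  ⊕-⊖ : ∀ c X → (c ⊕ X) ⊖ X ≡ c
  ⊕-⊖ c X = trans (⊕-⊕ c X (m ∸ X % m)) (⊕-inverse c X)

  ⊖-⊕ : ∀ x X → (x ⊖ X) ⊕ X ≡ x
  ⊖-⊕ x X = begin
    (x ⊖ X) ⊕ X             ≡⟨ ⊕-⊕ x (m ∸ X % m) X ⟩
    x ⊕ ((m ∸ X % m) + X)   ≡⟨ cong (x ⊕_) (+-comm (m ∸ X % m) X) ⟩
    x ⊕ (X + (m ∸ X % m))   ≡⟨ ⊕-inverse x X ⟩
    x                       ∎
    where open ≡-Reasoning

  ⊕-cancel : ∀ c c′ X → c ⊕ X ≡ c′ ⊕ X → c ≡ c′
  ⊕-cancel c c′ X e = trans (sym (⊕-⊖ c X)) (trans (cong (_⊖ X) e) (⊕-⊖ c′ X))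

  -- the operations +ₙ and -ₙ of Defs (note a +ₙ d is a ⊕ toℕ d): a + d - d = a, - - d = d
  +ₙ-inverse : ∀ (a d : Fin m) → (a +ₙ d) +ₙ (-ₙ d) ≡ a
  +ₙ-inverse a d = trans (⊕-cong (a +ₙ d) (toℕ (-ₙ d)) (m ∸ toℕ d % m) neg-d≡) (⊕-⊖ a (toℕ d))
    where
    neg-d≡ : toℕ (-ₙ d) % m ≡ (m ∸ toℕ d % m) % m
    neg-d≡ = trans (cong (_% m) (toℕ-mod (m ∸ toℕ d)))
               (trans (m%n%n≡m%n (m ∸ toℕ d) m) (cong (λ z → (m ∸ z) % m) (sym (toℕ%m d))))

  -ₙ-involutive : ∀ (d : Fin m) → -ₙ (-ₙ d) ≡ d
  -ₙ-involutive d = toℕ-injective (trans (toℕ-mod (m ∸ toℕ (-ₙ d)))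
    (trans (cong (λ z → (m ∸ z) % m) (toℕ-mod (m ∸ toℕ d))) (double-negation (toℕ d) (toℕ<n d))))
    where
    double-negation : ∀ D → D < m → (m ∸ (m ∸ D) % m) % m ≡ D
    double-negation zero _ = trans (cong (λ z → (m ∸ z) % m) (n%n≡0 m)) (n%n≡0 m)
    double-negation (suc D) D<m =
      trans (cong (λ z → (m ∸ z) % m) (m<n⇒m%n≡m (s≤s (m∸n≤m m′ D))))
        (trans (cong (_% m) (m∸[m∸n]≡n (<⇒≤ D<m))) (m<n⇒m%n≡m D<m))

  toℕ-sucₙ : ∀ (j : Fin m) → toℕ (sucₙ j) ≡ suc (toℕ j) ⊎ (toℕ j ≡ m′ × toℕ (sucₙ j) ≡ 0)
  toℕ-sucₙ j with suc (toℕ j) <? m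
  ... | yes j+1<m = inj₁ (trans (toℕ-mod (suc (toℕ j))) (m<n⇒m%n≡m j+1<m))
  ... | no j+1≮m = inj₂ (j≡m′ , trans (toℕ-mod (suc (toℕ j))) (trans (cong (λ z → suc z % m) j≡m′) (n%n≡0 m)))
    where
    j≡m′ : toℕ j ≡ m′
    j≡m′ = suc-injective (≤-antisym (toℕ<n j) (≮⇒≥ j+1≮m))

  infix 4 _⟶_

  _⟶_ : ℕ → ℕ → Set
  X ⟶ Y = Y % m ≡ suc X % m

  Step : ℕ → ℕ → Set
  Step X Y = X ⟶ Y ⊎ Y ⟶ X

  ⊕-⟶ : ∀ c X Y → X ⟶ Y → c ⊕ Y ≡ sucₙ (c ⊕ X)
  ⊕-⟶ c X Y X⟶Y = mod-cong (toℕ c + Y) (suc (toℕ (c ⊕ X))) (begin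
    (toℕ c + Y) % m             ≡⟨ +-cong-% (toℕ c) Y (suc X) X⟶Y ⟩
    (toℕ c + suc X) % m         ≡⟨ cong (_% m) (+-suc (toℕ c) X) ⟩
    suc (toℕ c + X) % m         ≡⟨ %-absorbʳ 1 (toℕ c + X) ⟨
    suc ((toℕ c + X) % m) % m   ≡⟨ cong (λ z → suc z % m) (toℕ-mod (toℕ c + X)) ⟨
    suc (toℕ (c ⊕ X)) % m       ∎)
    where open ≡-Reasoning

  -- multiplication by m-1 ≡ -1 reverses the direction of a step
  reflect-⟶ : ∀ X Y → X ⟶ Y → m′ * Y ⟶ m′ * X
  reflect-⟶ X Y X⟶Y = sym (begin
    suc (m′ * Y) % m       ≡⟨ +-cong-% 1 (m′ * Y) (m′ * suc X) (*-cong-% m′ Y (suc X) X⟶Y) ⟩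
    suc (m′ * suc X) % m   ≡⟨ cong (λ z → suc z % m) (*-suc m′ X) ⟩
    (m + m′ * X) % m       ≡⟨ cong (_% m) (+-comm m (m′ * X)) ⟩
    (m′ * X + m) % m       ≡⟨ [m+n]%n≡m%n (m′ * X) m ⟩
    (m′ * X) % m           ∎)
    where open ≡-Reasoning

module Circulant (n′ : ℕ) (S : Subset (suc n′)) where
  open Modular n′ using (+ₙ-inverse; -ₙ-involutive)

  -ₙ∈±S : ∀ {d} → d ∈ S → (± S) (-ₙ d)
  -ₙ∈±S {d} d∈S = inj₂ (subst (_∈ S) (sym (-ₙ-involutive d)) d∈S)

  ±S⇒CircAdj : ∀ d → (± S) d → ∀ i → CircAdj S i (i +ₙ d)
  ±S⇒CircAdj d (inj₁ d∈S) i = d , d∈S , inj₁ refl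
  ±S⇒CircAdj d (inj₂ -d∈S) i = -ₙ d , -d∈S , inj₂ (sym (+ₙ-inverse i d))

  edge∈C[±S] : ∀ {m} {x y : Fin m} {i k} → LexAdj (x , i) (y , k) → CircAdj S i k →
               InCmD (± S) (x , i) (y , k)
  edge∈C[±S] (inj₁ y≡x+1) (d , d∈S , inj₁ k≡i+d) = d , inj₁ d∈S , inj₁ (y≡x+1 , k≡i+d)
  edge∈C[±S] {k = k} (inj₁ y≡x+1) (d , d∈S , inj₂ i≡k+d) =
    -ₙ d , -ₙ∈±S d∈S , inj₁ (y≡x+1 , sym (trans (cong (_+ₙ (-ₙ d)) i≡k+d) (+ₙ-inverse k d)))
  edge∈C[±S] (inj₂ x≡y+1) (d , d∈S , inj₂ i≡k+d) = d , inj₁ d∈S , inj₂ (x≡y+1 , i≡k+d)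
  edge∈C[±S] {i = i} (inj₂ x≡y+1) (d , d∈S , inj₁ k≡i+d) =
    -ₙ d , -ₙ∈±S d∈S , inj₂ (x≡y+1 , sym (trans (cong (_+ₙ (-ₙ d)) k≡i+d) (+ₙ-inverse i d)))

InCmD-sym : ∀ {m n} (D : Fin n → Set) {x y : Fin m} {i j : Fin n} →
            InCmD D (x , i) (y , j) → InCmD D (y , j) (x , i)
InCmD-sym D (d , d∈D , inj₁ e) = d , d∈D , inj₂ e
InCmD-sym D (d , d∈D , inj₂ e) = d , d∈D , inj₁ e

module Walks (m′ n′ : ℕ) where
  open Modular m′ using (_⟶_; Step; reflect-⟶)

  n : ℕ
  n = suc n′

  ClosedWalk : (Fin n → ℕ) → Set
  ClosedWalk w = ∀ j → Step (w j) (w (sucₙ j))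

  closed-walk : (W : ℕ → ℕ) → (∀ J → Step (W J) (W (suc J))) → Step (W n′) (W 0) →
                ClosedWalk (λ j → W (toℕ j))
  closed-walk W step wrap j with Modular.toℕ-sucₙ n′ j
  ... | inj₁ e = subst (λ z → Step (W (toℕ j)) (W z)) (sym e) (step (toℕ j))
  ... | inj₂ (j≡n′ , j+1≡0) = subst₂ (λ a b → Step (W a) (W b)) (sym j≡n′) (sym j+1≡0) wrap

  reflect : (Fin n → ℕ) → Fin n → ℕ
  reflect w j = m′ * w j

  reflect-closed : ∀ w → ClosedWalk w → ClosedWalk (reflect w)
  reflect-closed w closed j with closed j
  ... | inj₁ up = inj₂ (reflect-⟶ (w j) (w (sucₙ j)) up)
  ... | inj₂ down = inj₁ (reflect-⟶ (w (sucₙ j)) (w j) down)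

module Factor (m′ n′ : ℕ) {S : Subset (suc n′)} (H : HamCycle (suc n′) S) where
  open Modular m′ using (m; _⟶_; _⊕_; _⊖_; ⊕-⟶; ⊕-cancel; ⊖-⊕)
  open Walks m′ n′ using (n; ClosedWalk)
  open Circulant n′ S using (edge∈C[±S])
  open HamCycle H

  module _ (w : Fin n → ℕ) (closed : ClosedWalk w) where

    cycle : Fin m → Fin n → Vertex m n
    cycle c j = c ⊕ w j , vert j

    cycle-adj : ∀ c j → LexAdj (cycle c j) (cycle c (sucₙ j))
    cycle-adj c j with closed j
    ... | inj₁ up = inj₁ (⊕-⟶ c (w j) (w (sucₙ j)) up)
    ... | inj₂ down = inj₂ (⊕-⟶ c (w (sucₙ j)) (w j) down)

    cycle-injective : ∀ c j c′ j′ → cycle c j ≡ cycle c′ j′ → c ≡ c′ × j ≡ j′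
    cycle-injective c j c′ j′ e with inj j j′ (cong proj₂ e)
    ... | refl = ⊕-cancel c c′ (w j) (cong proj₁ e) , refl

    -- x_{v_j} lies on the cycle c = x - w_j
    cycle-surjective : ∀ v → Σ (Fin m) λ c → Σ (Fin n) λ j → cycle c j ≡ v
    cycle-surjective (x , i) with injective⇒surjective vert inj i
    ... | j , vj≡i = x ⊖ w j , j , cong₂ _,_ (⊖-⊕ x (w j)) vj≡i

    factor : CnFactor m n
    factor = record
      { cyc = cycle ; inj = cycle-injective ; surj = cycle-surjective ; adj = cycle-adj }

    factor⊆C[±S] : ∀ p q → FactorEdge factor p q → InCmD (± S) p q
    factor⊆C[±S] _ _ (c , j , inj₁ (refl , refl)) = edge∈C[±S] (cycle-adj c j) (adj j)
    factor⊆C[±S] _ _ (c , j , inj₂ (refl , refl)) = InCmD-sym (± S) (edge∈C[±S] (cycle-adj c j) (adj j))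

    ascent-edges : ∀ j → w j ⟶ w (sucₙ j) → ∀ x →
                   FactorEdge factor (x , vert j) (sucₙ x , vert (sucₙ j))
    ascent-edges j up x = c , j , inj₁ (cong (_, vert j) c+wj≡x , cong (_, vert (sucₙ j)) c+wj+1≡x+1)
      where
      c = x ⊖ w j
      c+wj≡x : c ⊕ w j ≡ x
      c+wj≡x = ⊖-⊕ x (w j)
      c+wj+1≡x+1 : c ⊕ w (sucₙ j) ≡ sucₙ x
      c+wj+1≡x+1 = trans (⊕-⟶ c (w j) (w (sucₙ j)) up) (cong sucₙ c+wj≡x)

    descent-edges : ∀ j → w (sucₙ j) ⟶ w j → ∀ x →
                    FactorEdge factor (x , vert (sucₙ j)) (sucₙ x , vert j)
    descent-edges j down x = c , j , inj₂ (cong (_, vert j) c+wj≡x+1 , cong (_, vert (sucₙ j)) c+wj+1≡x)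
      where
      c = x ⊖ w (sucₙ j)
      c+wj+1≡x : c ⊕ w (sucₙ j) ≡ x
      c+wj+1≡x = ⊖-⊕ x (w (sucₙ j))
      c+wj≡x+1 : c ⊕ w j ≡ sucₙ x
      c+wj≡x+1 = trans (⊕-⟶ c (w (sucₙ j)) (w j) down) (cong sucₙ c+wj+1≡x)

module Covering (m′ n′ : ℕ) where
  open Modular m′ using (m; _⟶_)
  open Walks m′ n′ using (n; ClosedWalk)
  open Circulant n′ using (±S⇒CircAdj)

  factors-exactly-cover : ∀ {S : Subset n} {s t} (W : Fin s → Fin n → ℕ) →
    (∀ r → ClosedWalk (W r)) →
    (∀ j → Σ (Fin s) λ r → W r j ⟶ W r (sucₙ j)) →
    (∀ j → Σ (Fin s) λ r → W r (sucₙ j) ⟶ W r j) →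
    HamDecomp n S t → Σ (Fin (s * t) → CnFactor m n) λ Fs → ExactlyCovers Fs (± S)
  factors-exactly-cover {S} {s} {t} W closed ascends descends (H , edge-in-unique-cycle) =
    Fs , covers , exact
    where
    F : Fin s × Fin t → CnFactor m n
    F (r , k) = Factor.factor m′ n′ (H k) (W r) (closed r)

    Fs : Fin (s * t) → CnFactor m n
    Fs l = F (remQuot {s} t l)

    reindex : ∀ r k {p q} → FactorEdge (F (r , k)) p q → Σ (Fin (s * t)) λ l → FactorEdge (Fs l) p q
    reindex r k {p} {q} e =
      combine r k , subst (λ z → FactorEdge (F z) p q) (sym (remQuot-combine r k)) e

    exact : ∀ l p q → FactorEdge (Fs l) p q → InCmD (± S) p q
    exact l = Factor.factor⊆C[±S] m′ n′ (H k) (W r) (closed r)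
      where
      r = proj₁ (remQuot {s} t l)
      k = proj₂ (remQuot {s} t l)

    -- the edge {i, i+d} of ⟨S⟩_n is traversed by some H_k, forwards or backwards; a walk
    -- ascending (resp. descending) at that step yields a factor containing x_i (x+1)_{i+d}
    covers : Covers Fs (± S)
    covers d d∈±S x i = cover (proj₁ (edge-in-unique-cycle i (i +ₙ d) (±S⇒CircAdj S d d∈±S i)))
      where
      cover : Σ (Fin t) (λ k → CycEdge (H k) i (i +ₙ d)) →
              Σ (Fin (s * t)) λ l → FactorEdge (Fs l) (x , i) (sucₙ x , i +ₙ d)
      cover (k , j , inj₁ (vj≡i , vj+1≡i+d)) =
        let (r , up) = ascends j in
        reindex r k (subst₂ (λ a b → FactorEdge (F (r , k)) (x , a) (sucₙ x , b)) vj≡i vj+1≡i+d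
          (Factor.ascent-edges m′ n′ (H k) (W r) (closed r) j up x))
      cover (k , j , inj₂ (vj≡i+d , vj+1≡i)) =
        let (r , down) = descends j in
        reindex r k (subst₂ (λ a b → FactorEdge (F (r , k)) (x , a) (sucₙ x , b)) vj+1≡i vj≡i+d
          (Factor.descent-edges m′ n′ (H k) (W r) (closed r) j down x))

module Zigzag (m′ k : ℕ) where
  open Modular m′ using (m; _⟶_; Step; reflect-⟶)
  open Walks m′ (2 * k + m′) using (n; ClosedWalk; closed-walk; reflect; reflect-closed)

  zigzag : ℕ → ℕ
  zigzag J with J <? 2 * k
  ... | yes _ = J % 2
  ... | no _ = J ∸ 2 * k

  parity-step : ∀ i → Step (i % 2) (suc i % 2)
  parity-step zero = inj₁ refl
  parity-step (suc zero) = inj₂ refl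
  parity-step (suc (suc i)) = parity-step i

  zigzag-step : ∀ J → Step (zigzag J) (zigzag (suc J))
  zigzag-step J with J <? 2 * k | suc J <? 2 * k
  ... | yes _ | yes _ = parity-step J
  ... | yes J<2k | no J+1≮2k = subst (Step (J % 2)) both-zero (parity-step J)
    where
    J+1≡2k : suc J ≡ 2 * k
    J+1≡2k = ≤-antisym J<2k (≮⇒≥ J+1≮2k)
    both-zero : suc J % 2 ≡ suc J ∸ 2 * k
    both-zero = begin
      suc J % 2    ≡⟨ cong (_% 2) J+1≡2k ⟩
      2 * k % 2    ≡⟨ cong (_% 2) (*-comm 2 k) ⟩
      k * 2 % 2    ≡⟨ m*n%n≡0 k 2 ⟩
      0            ≡⟨ n∸n≡0 (2 * k) ⟨
      2 * k ∸ 2 * k ≡⟨ cong (_∸ 2 * k) J+1≡2k ⟨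
      suc J ∸ 2 * k ∎
      where open ≡-Reasoning
  ... | no J≮2k | yes J+1<2k = ⊥-elim (J≮2k (<-trans (n<1+n J) J+1<2k))
  ... | no J≮2k | no _ = inj₁ (cong (_% m) (+-∸-assoc 1 (≮⇒≥ J≮2k)))

  zigzag-start : zigzag 0 ≡ 0
  zigzag-start with 0 <? 2 * k
  ... | yes _ = refl
  ... | no _ = 0∸n≡0 (2 * k)

  zigzag-end : zigzag (2 * k + m′) ≡ m′
  zigzag-end with 2 * k + m′ <? 2 * k
  ... | yes end<2k = ⊥-elim (≤⇒≯ (m≤m+n (2 * k) m′) end<2k)
  ... | no _ = m+n∸m≡n (2 * k) m′

  zigzag-wrap : Step (zigzag (2 * k + m′)) (zigzag 0)
  zigzag-wrap = subst₂ Step (sym zigzag-end) (sym zigzag-start) (inj₁ (sym (n%n≡0 m)))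

  zigzagₙ : Fin n → ℕ
  zigzagₙ j = zigzag (toℕ j)

  zigzagₙ-closed : ClosedWalk zigzagₙ
  zigzagₙ-closed = closed-walk zigzag zigzag-step zigzag-wrap

  walks : Fin 2 → Fin n → ℕ
  walks 0F = zigzagₙ
  walks 1F = reflect zigzagₙ

  walks-closed : ∀ r → ClosedWalk (walks r)
  walks-closed 0F = zigzagₙ-closed
  walks-closed 1F = reflect-closed zigzagₙ zigzagₙ-closed

  some-walk-ascends : ∀ j → Σ (Fin 2) λ r → walks r j ⟶ walks r (sucₙ j)
  some-walk-ascends j with zigzagₙ-closed j
  ... | inj₁ up = 0F , up
  ... | inj₂ down = 1F , reflect-⟶ (zigzagₙ (sucₙ j)) (zigzagₙ j) down

  some-walk-descends : ∀ j → Σ (Fin 2) λ r → walks r (sucₙ j) ⟶ walks r j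
  some-walk-descends j with zigzagₙ-closed j
  ... | inj₁ up = 1F , reflect-⟶ (zigzagₙ j) (zigzagₙ (sucₙ j)) up
  ... | inj₂ down = 0F , down

factors-for-even-gap : ∀ m′ k t (S : Subset (suc (2 * k + m′))) → HamDecomp (suc (2 * k + m′)) S t →
  Σ (Fin (2 * t) → CnFactor (suc m′) (suc (2 * k + m′))) λ Fs → ExactlyCovers Fs (± S)
factors-for-even-gap m′ k t S = Covering.factors-exactly-cover m′ (2 * k + m′) walks walks-closed
  some-walk-ascends some-walk-descends
  where open Zigzag m′ k

odd-gap : ∀ a b → 2 * b ≤ 2 * a → 2 * (a ∸ b) + 2 * b ≡ 2 * a
odd-gap a b 2b≤2a = trans (cong (_+ 2 * b) (*-distribˡ-∸ 2 a b)) (m∸n+n≡m 2b≤2a)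

-- Write m = 2b + 1 and n = 2a + 1; then n = 2(a - b) + m.
lemma2p5 : (m n t : ℕ) → 3 ≤ m → m ≤ n → Odd m → Odd n → (S : Subset n) →
    HamDecomp n S t →
    Σ (Fin (2 * t) → CnFactor m n) λ Fs → ExactlyCovers Fs (± S)
lemma2p5 _ _ t _ (s≤s 2b≤2a) (b , refl) (a , refl) =
  subst (λ N → (S : Subset (suc N)) → HamDecomp (suc N) S t →
               Σ (Fin (2 * t) → CnFactor (suc (2 * b)) (suc N)) λ Fs → ExactlyCovers Fs (± S))
        (odd-gap a b 2b≤2a) (factors-for-even-gap (2 * b) (a ∸ b) t)
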